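{- Let $d\geq 1$ and $k\geq 1$ be integers and let $q$ be a prime power with $q\geq dk+1$. Let $x_1,\dots,x_{dk+1}$ be the first $dk+1$ elements of $\mathbb{F}_q$ in a fixed order. For $i\geq 0$ let $M_i=M_{q^{2^i},k,d}$ be the binary matrix whose rows are indexed by pairs $(x_l,y)$ with $1\le l\le dk+1$ and $y\in\mathbb{F}_{q^{2^i}}$, whose columns are indexed by polynomials $f\in\mathbb{F}_{q^{2^i}}[x]$ of degree at most $k$, with entry $1$ iff $f(x_l)=y$, where rows and columns are ordered so that those indexed by $y\in\mathbb{F}_{q^{2^{i-1}}}$ and by polynomials over $\mathbb{F}_{q^{2^{i-1}}}$ come first, in the order used for $M_{i-1}$ (here $\mathbb{F}_{q^{2^{i-1}}}\subseteq\mathbb{F}_{q^{2^i}}$). Then $(M_i)_{i\geq 0}$ is a monotone family of $d$-CFF$(t=(dk+1)q^{2^i},\, n=q^{2^i(k+1)})$. Moreover its compression ratio is $\rho(n)=n^{1-\frac{1}{k+1}}$, i.e. $n/t$ is $O(n^{1-1/(k+1)})$.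
   Context: A $d$-CFF$(t,n)$ is a set system with $t$ points and $n$ blocks in which no block is contained in the union of any $d$ other blocks, represented by its $t\times n$ binary incidence matrix (rows = points, columns = blocks). An embedding family is a sequence $(\mathcal{M}^{(l)})_l$ of incidence matrices of set systems $(X_l,\mathcal{B}_l)$, $\mathcal{M}^{(l)}$ a $d(l)$-CFF, with $X_l\subseteq X_{l+1}$, nondecreasing numbers of rows and columns, $d(l)\le d(l+1)$, and $\mathcal{M}^{(l+1)}=\begin{pmatrix}\mathcal{M}^{(l)}&Y\\ Z&W\end{pmatrix}$ for some $Y,Z,W$. A monotone family of $d$-CFFs is an embedding family with $d(l)=d$ fixed such that the block $Z$ is always a zero matrix. -}

module Defs where

open import Data.Nat using (ℕ; zero; suc; _≤_)
import Data.Nat as ℕ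
open import Data.Nat.Primality using (Prime)
open import Data.Fin using (Fin; toℕ)
open import Data.Bool using (Bool; true; false)
open import Data.Vec using (Vec; []; _∷_)
import Data.Vec as Vec
open import Data.List using (List; length)
open import Data.List.Relation.Unary.All using (All)
open import Data.List.Membership.Propositional using (_∉_)
open import Data.Product using (Σ; ∃; ∃-syntax; _×_; _,_; proj₁; proj₂)
open import Relation.Binary.PropositionalEquality using (_≡_)
open import Relation.Binary.Definitions using (DecidableEquality)
open import Relation.Nullary using (¬_)
open import Relation.Nullary.Decidable using (⌊_⌋)
open import Algebra.Structures using (IsCommutativeRing)

IsPrimePower : ℕ → Set
IsPrimePower q = ∃[ p ] ∃[ m ] (Prime p × q ≡ p ℕ.^ suc m)

-- A t × n binary matrix (rows = points, columns = blocks).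
Matrix : ℕ → ℕ → Set
Matrix t n = Fin t → Fin n → Bool

IsCFF : ∀ {t n} → ℕ → Matrix t n → Set
IsCFF {t} {n} d M =
  (j : Fin n) (S : List (Fin n)) → length S ≤ d → j ∉ S →
  ∃[ r ] (M r j ≡ true × All (λ s → M r s ≡ false) S)

-- Monotone family of d-CFFs (an embedding family with fixed d and Z = 0).
-- Row/column indices of level i are the first t i / n i indices of level i+1.
record MonotoneFamily (d : ℕ) (t n : ℕ → ℕ)
                      (M : (i : ℕ) → Matrix (t i) (n i)) : Set where
  field
    cff     : ∀ i → IsCFF d (M i)
    rows-≤  : ∀ i → t i ≤ t (suc i)
    cols-≤  : ∀ i → n i ≤ n (suc i)
    embed   : ∀ i (r : Fin (t i)) (r' : Fin (t (suc i)))
                  (c : Fin (n i)) (c' : Fin (n (suc i))) →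
              toℕ r ≡ toℕ r' → toℕ c ≡ toℕ c' → M (suc i) r' c' ≡ M i r c
    -- lower-left block Z of M (i+1) is zero
    Z-zero  : ∀ i (r' : Fin (t (suc i))) (c : Fin (n i)) (c' : Fin (n (suc i))) →
              t i ≤ toℕ r' → toℕ c ≡ toℕ c' → M (suc i) r' c' ≡ false

record Field : Set₁ where
  infixl 6 _+_
  infixl 7 _*_
  field
    Carrier : Set
    _+_ _*_ : Carrier → Carrier → Carrier
    -_      : Carrier → Carrier
    0# 1#   : Carrier
    isCommutativeRing : IsCommutativeRing _≡_ _+_ _*_ -_ 0# 1#
    0≢1     : ¬ (0# ≡ 1#)
    inverse : ∀ x → ¬ (x ≡ 0#) → ∃[ y ] (x * y ≡ 1#)
    _≟_     : DecidableEquality Carrier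

open Field using (Carrier)

record FieldHom (F G : Field) : Set where
  private
    module F = Field F
    module G = Field G
  field
    ⟦_⟧   : Carrier F → Carrier G
    +-hom : ∀ x y → ⟦ x F.+ y ⟧ ≡ ⟦ x ⟧ G.+ ⟦ y ⟧
    *-hom : ∀ x y → ⟦ x F.* y ⟧ ≡ ⟦ x ⟧ G.* ⟦ y ⟧
    0-hom : ⟦ F.0# ⟧ ≡ G.0#
    1-hom : ⟦ F.1# ⟧ ≡ G.1#

open FieldHom using (⟦_⟧)

-- Polynomials of degree ≤ k: coefficient vectors (a₀, …, a_k), low degree first

Poly : Field → ℕ → Set
Poly F k = Vec (Carrier F) (suc k)

eval : (F : Field) → ∀ {m} → Vec (Carrier F) m → Carrier F → Carrier F
eval F []       x = Field.0# F
eval F (a ∷ as) x = Field._+_ F a (Field._*_ F x (eval F as x))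

lift : (F : ℕ → Field) → (∀ i → FieldHom (F i) (F (suc i))) →
       ∀ i → Carrier (F 0) → Carrier (F i)
lift F emb zero    x = x
lift F emb (suc i) x = ⟦ emb i ⟧ (lift F emb i x)

rowsM : (d k q : ℕ) → ℕ → ℕ
rowsM d k q i = (d ℕ.* k ℕ.+ 1) ℕ.* q ℕ.^ (2 ℕ.^ i)

colsM : (k q : ℕ) → ℕ → ℕ
colsM k q i = q ℕ.^ (2 ℕ.^ i ℕ.* (k ℕ.+ 1))

RSMatrix : (d k : ℕ) (F : ℕ → Field) (emb : ∀ i → FieldHom (F i) (F (suc i)))
           (xs : Fin (d ℕ.* k ℕ.+ 1) → Carrier (F 0)) (i : ℕ) {t n : ℕ}
           (row : Fin t → Fin (d ℕ.* k ℕ.+ 1) × Carrier (F i))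
           (col : Fin n → Poly (F i) k) → Matrix t n
RSMatrix d k F emb xs i row col r c =
  ⌊ Field._≟_ (F i) (eval (F i) (col c) (lift F emb i (xs (proj₁ (row r)))))
                    (proj₂ (row r)) ⌋

-- Fix a column with polynomial f. For any other column g, f - g is a nonzero polynomial of
-- degree ≤ k and so has at most k roots; hence d other columns together agree with f at no
-- more than dk of the dk + 1 points x_l, and at a remaining point x_l the row (x_l, f(x_l))
-- contains f but none of them. Field embeddings are injective and commute with evaluation,
-- so M_(i+1) restricted to old rows and old columns is M_i, and an old polynomial never takes
-- a new value at an old point, which makes Z zero. Finally n = Q^(k+1) ≤ ((dk+1) Q)^(k+1) = t^(k+1)
-- for Q = q^(2^i).

module Submission where

open import Defs
open import Data.Nat using (ℕ; zero; suc; _≤_; _<_; z≤n; s≤s; NonZero; >-nonZero)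
open import Data.Nat.Properties using (≮⇒≥)
open import Data.Fin using (Fin; toℕ; inject≤)
open import Data.Fin.Properties using (toℕ-inject≤; toℕ<n)
open import Data.Vec using (Vec; []; _∷_; zipWith)
import Data.Vec as Vec
open import Data.Vec.Relation.Unary.All using ([]; _∷_) renaming (All to AllV)
open import Data.List using (List; []; _∷_; length; filter; allFin; map)
import Data.List.Properties as List
open import Data.List.Relation.Unary.All using (All; []; _∷_)
import Data.List.Relation.Unary.All as All
import Data.List.Relation.Unary.All.Properties as All
open import Data.List.Relation.Unary.Any using (here)
open import Data.List.Relation.Unary.AllPairs using ([]; _∷_)
open import Data.List.Relation.Unary.Unique.Propositional using (Unique)
import Data.List.Relation.Unary.Unique.Propositional.Properties as Unique
open import Data.List.Membership.Propositional using (_∈_)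
open import Data.List.Membership.Propositional.Properties using (∈-filter⁻; ∈-map⁻)
open import Data.Bool using (true; false)
open import Data.Maybe using (nothing)
open import Data.Product using (∃-syntax; _×_; _,_; proj₁; proj₂; map₂)
open import Function.Base using (_∘_)
open import Function.Bundles using (_↔_; _⇔_; Inverse; Injection; mk⇔)
open import Function.Definitions using (Injective)
open import Function.Properties.Inverse using (Inverse⇒Injection)
open import Relation.Binary.PropositionalEquality using (_≡_; _≢_; refl; sym; trans; cong; cong₂; subst; module ≡-Reasoning)
open import Relation.Nullary using (¬_; Dec; yes; no; ¬?; contradiction)
open import Relation.Nullary.Decidable using (⌊_⌋; isYes≗does; dec-true; dec-false; does-⇔)
open import Relation.Unary using (Decidable)
open import Algebra.Bundles using (CommutativeRing)
import Algebra.Properties.Ring as RingProperties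
open import Tactic.RingSolver.Core.AlmostCommutativeRing using (AlmostCommutativeRing; fromCommutativeRing)
open import Tactic.RingSolver using (solve-∀)

module FieldProperties (F : Field) where
  open Field F

  commutativeRing : CommutativeRing _ _
  commutativeRing = record { isCommutativeRing = isCommutativeRing }

  open CommutativeRing commutativeRing public
    using (+-identityˡ; +-identityʳ; *-identityˡ; *-assoc; *-comm; zeroˡ; zeroʳ; -‿inverseʳ)
  open RingProperties (CommutativeRing.ring commutativeRing) public
    using (+-identityˡ-unique) renaming (x∙y⁻¹≈ε⇒x≈y to x-y≡0⇒x≡y)

  x+y*0≡x : ∀ x y → x + y * 0# ≡ x
  x+y*0≡x x y = trans (cong (x +_) (zeroʳ y)) (+-identityʳ x)

  x-x*y≡0 : ∀ x y → (x + - x) * y ≡ 0#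
  x-x*y≡0 x y = trans (cong (_* y) (-‿inverseʳ x)) (zeroˡ y)

  x≢0∧x*y≡0⇒y≡0 : ∀ {x y} → ¬ x ≡ 0# → x * y ≡ 0# → y ≡ 0#
  x≢0∧x*y≡0⇒y≡0 {x} {y} x≢0 xy≡0 with inverse x x≢0
  ... | z , xz≡1 = begin
    y             ≡⟨ sym (*-identityˡ y) ⟩
    1# * y        ≡⟨ cong (_* y) (trans (sym xz≡1) (*-comm x z)) ⟩
    (z * x) * y   ≡⟨ *-assoc z x y ⟩
    z * (x * y)   ≡⟨ cong (z *_) xy≡0 ⟩
    z * 0#        ≡⟨ zeroʳ z ⟩
    0#            ∎
    where open ≡-Reasoning

module RingIdentities (F : Field) where
  ring : AlmostCommutativeRing _ _
  ring = fromCommutativeRing (FieldProperties.commutativeRing F) (λ _ → nothing)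

  open AlmostCommutativeRing ring

  -- The solver does not cancel a + - a, so the step of synthetic division is
  -- stated with - a abstracted to n and the cancelling term (a + n) * B moved left.
  horner-step : ∀ c x a n B Q →
                (c + x * (B + (x + n) * Q)) + (a + n) * B ≡ (c + a * B) + (x + n) * (B + x * Q)
  horner-step = solve-∀ ring

  horner-sub : ∀ a b n x E v → ((a + n) + x * E) + (b + x * v) ≡ (a + x * (E + v)) + (b + n)
  horner-sub = solve-∀ ring

module Polynomial (F : Field) where
  open Field F
  open FieldProperties F
  open RingIdentities F

  -- Synthetic division: the quotient of h by X - a, whose remainder is h(a).
  divide : ∀ {m} → Carrier → Vec Carrier (suc m) → Vec Carrier m
  divide a (c ∷ [])      = []
  divide a (c ∷ c' ∷ cs) = eval F (c' ∷ cs) a ∷ divide a (c' ∷ cs)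

  eval-divide : ∀ {m} (h : Vec Carrier (suc m)) x a →
                eval F h x ≡ eval F h a + (x + - a) * eval F (divide a h) x
  eval-divide (c ∷ [])      x a =
    trans (x+y*0≡x c x) (sym (trans (x+y*0≡x _ (x + - a)) (x+y*0≡x c a)))
  eval-divide (c ∷ c' ∷ cs) x a = begin
    c + x * eval F (c' ∷ cs) x                     ≡⟨ cong (λ t → c + x * t) (eval-divide (c' ∷ cs) x a) ⟩
    c + x * (B + (x + - a) * Q)                    ≡⟨ sym (+-identityʳ _) ⟩
    (c + x * (B + (x + - a) * Q)) + 0#             ≡⟨ cong ((c + x * (B + (x + - a) * Q)) +_) (sym (x-x*y≡0 a B)) ⟩
    (c + x * (B + (x + - a) * Q)) + (a + - a) * B  ≡⟨ horner-step c x a (- a) B Q ⟩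
    (c + a * B) + (x + - a) * (B + x * Q)          ∎
    where
      open ≡-Reasoning
      B = eval F (c' ∷ cs) a
      Q = eval F (divide a (c' ∷ cs)) x

  IsZero : ∀ {m} → Vec Carrier m → Set
  IsZero = AllV (_≡ 0#)

  root∧divide-isZero⇒isZero : ∀ {m} (h : Vec Carrier (suc m)) a →
                              eval F h a ≡ 0# → IsZero (divide a h) → IsZero h
  root∧divide-isZero⇒isZero (c ∷ [])      a ha≡0 [] =
    trans (sym (x+y*0≡x c a)) ha≡0 ∷ []
  root∧divide-isZero⇒isZero (c ∷ c' ∷ cs) a ha≡0 (b≡0 ∷ q≡0) =
    trans (sym (trans (cong (λ t → c + a * t) b≡0) (x+y*0≡x c a))) ha≡0
      ∷ root∧divide-isZero⇒isZero (c' ∷ cs) a b≡0 q≡0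

  root⇒root-of-divide : ∀ {m} (h : Vec Carrier (suc m)) {a x} → ¬ a ≡ x →
                        eval F h a ≡ 0# → eval F h x ≡ 0# → eval F (divide a h) x ≡ 0#
  root⇒root-of-divide h {a} {x} a≢x ha≡0 hx≡0 =
    x≢0∧x*y≡0⇒y≡0 (λ x-a≡0 → a≢x (sym (x-y≡0⇒x≡y x a x-a≡0))) (begin
      (x + - a) * eval F (divide a h) x             ≡⟨ sym (+-identityˡ _) ⟩
      0# + (x + - a) * eval F (divide a h) x        ≡⟨ cong (_+ (x + - a) * eval F (divide a h) x) (sym ha≡0) ⟩
      eval F h a + (x + - a) * eval F (divide a h) x ≡⟨ sym (eval-divide h x a) ⟩
      eval F h x                                    ≡⟨ hx≡0 ⟩
      0#                                            ∎)
    where open ≡-Reasoning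

  roots⇒isZero : ∀ k (h : Vec Carrier (suc k)) (xs : List Carrier) → Unique xs → k < length xs →
                 All (λ x → eval F h x ≡ 0#) xs → IsZero h
  roots⇒isZero zero    h@(_ ∷ []) (a ∷ _)  _            _        (ha≡0 ∷ _)     =
    root∧divide-isZero⇒isZero h a ha≡0 []
  roots⇒isZero (suc k) h          (a ∷ xs) (a∉xs ∷ uxs) (s≤s k<) (ha≡0 ∷ hxs≡0) =
    root∧divide-isZero⇒isZero h a ha≡0 (roots⇒isZero k (divide a h) xs uxs k<
      (All.zipWith (λ (a≢x , hx≡0) → root⇒root-of-divide h a≢x ha≡0 hx≡0) (a∉xs , hxs≡0)))

  _-ᵖ_ : ∀ {m} → Vec Carrier m → Vec Carrier m → Vec Carrier m
  _-ᵖ_ = zipWith (λ a b → a + - b)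

  eval-sub : ∀ {m} (f g : Vec Carrier m) x → eval F (f -ᵖ g) x + eval F g x ≡ eval F f x
  eval-sub []      []      x = +-identityʳ 0#
  eval-sub (a ∷ f) (b ∷ g) x = begin
    ((a + - b) + x * eval F (f -ᵖ g) x) + (b + x * eval F g x) ≡⟨ horner-sub a b (- b) x _ _ ⟩
    (a + x * (eval F (f -ᵖ g) x + eval F g x)) + (b + - b)   ≡⟨ cong₂ (λ t u → (a + x * t) + u) (eval-sub f g x) (-‿inverseʳ b) ⟩
    (a + x * eval F f x) + 0#                                ≡⟨ +-identityʳ _ ⟩
    a + x * eval F f x                                       ∎
    where open ≡-Reasoning

  isZero-sub⇒≡ : ∀ {m} (f g : Vec Carrier m) → IsZero (f -ᵖ g) → f ≡ g
  isZero-sub⇒≡ []      []      []            = refl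
  isZero-sub⇒≡ (a ∷ f) (b ∷ g) (a-b≡0 ∷ f-g≡0) = cong₂ _∷_ (x-y≡0⇒x≡y a b a-b≡0) (isZero-sub⇒≡ f g f-g≡0)

  agree⇒≡ : ∀ k (f g : Poly F k) (xs : List Carrier) → Unique xs → k < length xs →
            All (λ x → eval F f x ≡ eval F g x) xs → f ≡ g
  agree⇒≡ k f g xs uxs k< agree = isZero-sub⇒≡ f g (roots⇒isZero k (f -ᵖ g) xs uxs k<
    (All.map (λ {x} fx≡gx → +-identityˡ-unique _ _ (trans (eval-sub f g x) fx≡gx)) agree))

  few-agreements : ∀ k (f g : Poly F k) → f ≢ g → (xs : List Carrier) → Unique xs →
                   length (filter (λ x → eval F f x ≟ eval F g x) xs) ≤ k
  few-agreements k f g f≢g xs uxs = ≮⇒≥ λ k<agreements →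
    f≢g (agree⇒≡ k f g (filter agree? xs) (Unique.filter⁺ agree? uxs) k<agreements (All.all-filter agree? xs))
    where
      agree? : Decidable (λ x → eval F f x ≡ eval F g x)
      agree? x = eval F f x ≟ eval F g x

⌊⌋-true : ∀ {a} {A : Set a} (a? : Dec A) → A → ⌊ a? ⌋ ≡ true
⌊⌋-true a? a = trans (isYes≗does a?) (dec-true a? a)

⌊⌋-false : ∀ {a} {A : Set a} (a? : Dec A) → ¬ A → ⌊ a? ⌋ ≡ false
⌊⌋-false a? ¬a = trans (isYes≗does a?) (dec-false a? ¬a)

⌊⌋-⇔ : ∀ {a b} {A : Set a} {B : Set b} → A ⇔ B → (a? : Dec A) (b? : Dec B) → ⌊ a? ⌋ ≡ ⌊ b? ⌋
⌊⌋-⇔ A⇔B a? b? = trans (isYes≗does a?) (trans (does-⇔ A⇔B a? b?) (sym (isYes≗does b?)))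

module FieldHomProperties {F G : Field} (φ : FieldHom F G) where
  private
    module F = Field F
    module G = Field G
    module FP = FieldProperties F
    module GP = FieldProperties G
  open FieldHom φ

  ⟦⟧-kernel : ∀ {x} → ⟦ x ⟧ ≡ G.0# → x ≡ F.0#
  ⟦⟧-kernel {x} ⟦x⟧≡0 with x F.≟ F.0#
  ... | yes x≡0 = x≡0
  ... | no  x≢0 with F.inverse x x≢0
  ...   | z , xz≡1 = contradiction (begin
          G.0#              ≡⟨ sym (GP.zeroˡ ⟦ z ⟧) ⟩
          G.0# G.* ⟦ z ⟧    ≡⟨ cong (G._* ⟦ z ⟧) (sym ⟦x⟧≡0) ⟩
          ⟦ x ⟧ G.* ⟦ z ⟧   ≡⟨ sym (*-hom x z) ⟩
          ⟦ x F.* z ⟧       ≡⟨ cong ⟦_⟧ xz≡1 ⟩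
          ⟦ F.1# ⟧          ≡⟨ 1-hom ⟩
          G.1#              ∎) G.0≢1
    where open ≡-Reasoning

  ⟦⟧-injective : Injective _≡_ _≡_ ⟦_⟧
  ⟦⟧-injective {x} {y} ⟦x⟧≡⟦y⟧ = FP.x-y≡0⇒x≡y x y (⟦⟧-kernel (begin
    ⟦ x F.+ F.- y ⟧           ≡⟨ +-hom x (F.- y) ⟩
    ⟦ x ⟧ G.+ ⟦ F.- y ⟧       ≡⟨ cong (G._+ ⟦ F.- y ⟧) ⟦x⟧≡⟦y⟧ ⟩
    ⟦ y ⟧ G.+ ⟦ F.- y ⟧       ≡⟨ sym (+-hom y (F.- y)) ⟩
    ⟦ y F.+ F.- y ⟧           ≡⟨ cong ⟦_⟧ (FP.-‿inverseʳ y) ⟩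
    ⟦ F.0# ⟧                  ≡⟨ 0-hom ⟩
    G.0#                      ∎))
    where open ≡-Reasoning

  eval-map : ∀ {m} (p : Vec F.Carrier m) x → eval G (Vec.map ⟦_⟧ p) ⟦ x ⟧ ≡ ⟦ eval F p x ⟧
  eval-map []      x = sym 0-hom
  eval-map (a ∷ p) x = begin
    ⟦ a ⟧ G.+ ⟦ x ⟧ G.* eval G (Vec.map ⟦_⟧ p) ⟦ x ⟧ ≡⟨ cong (λ t → ⟦ a ⟧ G.+ ⟦ x ⟧ G.* t) (eval-map p x) ⟩
    ⟦ a ⟧ G.+ ⟦ x ⟧ G.* ⟦ eval F p x ⟧               ≡⟨ cong (⟦ a ⟧ G.+_) (sym (*-hom x _)) ⟩
    ⟦ a ⟧ G.+ ⟦ x F.* eval F p x ⟧                   ≡⟨ sym (+-hom a _) ⟩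
    ⟦ a F.+ x F.* eval F p x ⟧                       ∎
    where open ≡-Reasoning

  ⌊⌋-eval-map : ∀ {m} (p : Vec F.Carrier m) x y →
                ⌊ eval G (Vec.map ⟦_⟧ p) ⟦ x ⟧ G.≟ ⟦ y ⟧ ⌋ ≡ ⌊ eval F p x F.≟ y ⌋
  ⌊⌋-eval-map p x y = ⌊⌋-⇔ (mk⇔ (⟦⟧-injective ∘ trans (sym (eval-map p x)))
                                 (trans (eval-map p x) ∘ cong ⟦_⟧)) _ _

  ⌊⌋-eval-map-∉image : ∀ {m} (p : Vec F.Carrier m) x y → (∀ v → y ≢ ⟦ v ⟧) →
                       ⌊ eval G (Vec.map ⟦_⟧ p) ⟦ x ⟧ G.≟ y ⌋ ≡ false
  ⌊⌋-eval-map-∉image p x y y∉image =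
    ⌊⌋-false _ (λ eq → y∉image (eval F p x) (trans (sym eq) (eval-map p x)))

lift-injective : ∀ (F : ℕ → Field) (emb : ∀ i → FieldHom (F i) (F (suc i))) i →
                 Injective _≡_ _≡_ (lift F emb i)
lift-injective F emb zero    eq = eq
lift-injective F emb (suc i) eq = lift-injective F emb i (FieldHomProperties.⟦⟧-injective (emb i) eq)

↔-to-injective : ∀ {A B : Set} (I : A ↔ B) → Injective _≡_ _≡_ (Inverse.to I)
↔-to-injective I = Injection.injective (Inverse⇒Injection I)

-- Imported only here: above, _+_ and _*_ are the field operations.
open import Data.Nat using (_+_; _*_; _^_)
open import Data.Nat.Properties
  using (+-suc; +-comm; ≤-trans; +-cancelˡ-<; +-monoˡ-≤; *-monoˡ-≤; *-monoʳ-≤; *-identityˡ; ≤-<-trans; <⇒≱; m≤n+m; m≤m+n; m<m+n;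
         m≤n*m; ^-monoˡ-≤; ^-monoʳ-≤; ^-*-assoc; module ≤-Reasoning)

length-filter-split : ∀ {A : Set} {P : A → Set} (P? : Decidable P) (xs : List A) →
                      length xs ≡ length (filter P? xs) + length (filter (¬? ∘ P?) xs)
length-filter-split P? []       = refl
length-filter-split P? (x ∷ xs) with P? x
... | yes _ = cong suc (length-filter-split P? xs)
... | no  _ = trans (cong suc (length-filter-split P? xs)) (sym (+-suc _ _))

module _ {A B : Set} (Bad : B → A → Set) (Bad? : ∀ s → Decidable (Bad s)) (k : ℕ) where

  FewBad : B → Set
  FewBad s = ∀ xs → Unique xs → length (filter (Bad? s) xs) ≤ k

  escape : (S : List B) (xs : List A) → Unique xs → length S * k < length xs → All FewBad S →
           ∃[ x ] (x ∈ xs × All (λ s → ¬ Bad s x) S)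
  escape []      (x ∷ _) _   _          _            = x , here refl , []
  escape (s ∷ S) xs      uxs |sS|k<|xs| (few ∷ fews) =
    let x , x∈good , good-for-S = escape S good (Unique.filter⁺ (¬? ∘ Bad? s) uxs) |S|k<|good| fews
        x∈xs , good-for-s       = ∈-filter⁻ (¬? ∘ Bad? s) x∈good
    in  x , x∈xs , good-for-s ∷ good-for-S
    where
      good : List A
      good = filter (¬? ∘ Bad? s) xs

      |S|k<|good| : length S * k < length good
      |S|k<|good| = +-cancelˡ-< k _ _ (begin-strict
        k + length S * k                           <⟨ |sS|k<|xs| ⟩
        length xs                                  ≡⟨ length-filter-split (Bad? s) xs ⟩
        length (filter (Bad? s) xs) + length good  ≤⟨ +-monoˡ-≤ (length good) (few xs uxs) ⟩
        k + length good                            ∎)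
        where open ≤-Reasoning

evalMatrix : (F : Field) {N t n k : ℕ} → (Fin N → Field.Carrier F) →
             (Fin t → Fin N × Field.Carrier F) → (Fin n → Poly F k) → Matrix t n
evalMatrix F e row col r c =
  ⌊ Field._≟_ F (eval F (col c) (e (proj₁ (row r)))) (proj₂ (row r)) ⌋

evalMatrix-at : (F : Field) {N t n k : ℕ} (e : Fin N → Field.Carrier F)
                (row : Fin t → Fin N × Field.Carrier F) (col : Fin n → Poly F k) →
                ∀ {r c l y f} → row r ≡ (l , y) → col c ≡ f →
                evalMatrix F e row col r c ≡ ⌊ Field._≟_ F (eval F f (e l)) y ⌋
evalMatrix-at F e row col = cong₂ (λ p f → ⌊ Field._≟_ F (eval F f (e (proj₁ p))) (proj₂ p) ⌋)

evalMatrix-isCFF : (F : Field) (d k : ℕ) {t n : ℕ} (e : Fin (d * k + 1) → Field.Carrier F) →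
                   Injective _≡_ _≡_ e →
                   (row : Fin t ↔ (Fin (d * k + 1) × Field.Carrier F)) (col : Fin n ↔ Poly F k) →
                   IsCFF d (evalMatrix F e (Inverse.to row) (Inverse.to col))
evalMatrix-isCFF F d k e e-injective row col j S |S|≤d j∉S =
  witness (escape Bad Bad? k S points (Unique.map⁺ e-injective (Unique.allFin⁺ _)) |S|k<|points| few)
  where
    open Field F using (Carrier; _≟_)
    open Polynomial F using (few-agreements)
    open Inverse
    M : Matrix _ _
    M = evalMatrix F e (to row) (to col)

    f : Poly F k
    f = to col j

    Bad : Fin _ → Carrier → Set
    Bad s x = eval F (to col s) x ≡ eval F f x

    Bad? : ∀ s → Decidable (Bad s)
    Bad? s x = eval F (to col s) x ≟ eval F f x

    points : List Carrier
    points = map e (allFin (d * k + 1))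

    |S|k<|points| : length S * k < length points
    |S|k<|points| = subst (length S * k <_)
      (sym (trans (List.length-map e (allFin _)) (List.length-tabulate (λ l → l))))
      (≤-<-trans (*-monoˡ-≤ k |S|≤d) (m<m+n (d * k) (s≤s z≤n)))

    few : All (FewBad Bad Bad? k) S
    few = All.tabulate λ s∈S →
      few-agreements k (to col _) f (λ eq → j∉S (subst (_∈ S) (↔-to-injective col eq) s∈S))

    witness : ∃[ x ] (x ∈ points × All (λ s → ¬ Bad s x) S) →
              ∃[ r ] (M r j ≡ true × All (λ s → M r s ≡ false) S)
    witness (x , x∈points , x-escapes) with l , _ , refl ← ∈-map⁻ e x∈points =
      from row (l , y) , hit , All.map miss x-escapes
      where
        y : Carrier
        y = eval F f (e l)

        at : ∀ c → M (from row (l , y)) c ≡ ⌊ eval F (to col c) (e l) ≟ y ⌋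
        at c = evalMatrix-at F e (to row) (to col) (strictlyInverseˡ row (l , y)) refl

        hit : M (from row (l , y)) j ≡ true
        hit = trans (at j) (⌊⌋-true _ refl)

        miss : ∀ {s} → ¬ Bad s (e l) → M (from row (l , y)) s ≡ false
        miss ¬bad = trans (at _) (⌊⌋-false _ ¬bad)

beyond-prefix-∉image : ∀ {A B : Set} {m m′ : ℕ} (I : Fin m ↔ A) (J : Fin m′ ↔ B) (φ : A → B) →
                       m ≤ m′ →
                       (∀ r r′ → toℕ r ≡ toℕ r′ → Inverse.to J r′ ≡ φ (Inverse.to I r)) →
                       ∀ r′ → m ≤ toℕ r′ → ∀ a → Inverse.to J r′ ≢ φ a
beyond-prefix-∉image {m = m} I J φ m≤m′ prefix r′ m≤r′ a Jr′≡φa =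
  <⇒≱ (subst (_< m) (trans (sym (toℕ-inject≤ r m≤m′)) (cong toℕ r↑≡r′)) (toℕ<n r)) m≤r′
  where
    open Inverse

    r : Fin _
    r = from I a

    r↑ : Fin _
    r↑ = inject≤ r m≤m′

    r↑≡r′ : r↑ ≡ r′
    r↑≡r′ = ↔-to-injective J (begin
      to J r↑          ≡⟨ prefix r r↑ (sym (toℕ-inject≤ r m≤m′)) ⟩
      φ (to I r)       ≡⟨ cong φ (strictlyInverseˡ I a) ⟩
      φ a              ≡⟨ sym Jr′≡φa ⟩
      to J r′          ∎)
      where open ≡-Reasoning

2^i≤2^[1+i] : ∀ i → 2 ^ i ≤ 2 ^ suc i
2^i≤2^[1+i] i = m≤m+n (2 ^ i) _

rowsM-mono : ∀ d k q .{{_ : NonZero q}} i → rowsM d k q i ≤ rowsM d k q (suc i)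
rowsM-mono d k q i = *-monoʳ-≤ (d * k + 1) (^-monoʳ-≤ q (2^i≤2^[1+i] i))

colsM-mono : ∀ k q .{{_ : NonZero q}} i → colsM k q i ≤ colsM k q (suc i)
colsM-mono k q i = ^-monoʳ-≤ q (*-monoˡ-≤ (k + 1) (2^i≤2^[1+i] i))

colsM≤rowsM^[k+1] : ∀ d k q i → colsM k q i ≤ rowsM d k q i ^ (k + 1)
colsM≤rowsM^[k+1] d k q i = subst (_≤ rowsM d k q i ^ (k + 1)) (^-*-assoc q (2 ^ i) (k + 1))
  (^-monoˡ-≤ (k + 1) (m≤n*m (q ^ 2 ^ i) (d * k + 1) {{>-nonZero (m≤n+m 1 (d * k))}}))

n^[k+1]≤t^[k+1]*n^k : ∀ {n t} k → n ≤ t ^ (k + 1) → n ^ (k + 1) ≤ 1 * t ^ (k + 1) * n ^ k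
n^[k+1]≤t^[k+1]*n^k {n} {t} k n≤t^[k+1] = begin
  n ^ (k + 1)              ≡⟨ cong (n ^_) (+-comm k 1) ⟩
  n * n ^ k                ≤⟨ *-monoˡ-≤ (n ^ k) n≤t^[k+1] ⟩
  t ^ (k + 1) * n ^ k      ≡⟨ cong (_* n ^ k) (sym (*-identityˡ (t ^ (k + 1)))) ⟩
  1 * t ^ (k + 1) * n ^ k  ∎
  where open ≤-Reasoning

module RSTower (d k q : ℕ) .{{_ : NonZero q}} (F : ℕ → Field) (emb : ∀ i → FieldHom (F i) (F (suc i)))
  (xs : Fin (d * k + 1) → Field.Carrier (F 0)) (xs-injective : Injective _≡_ _≡_ xs)
  (row : ∀ i → Fin (rowsM d k q i) ↔ (Fin (d * k + 1) × Field.Carrier (F i)))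
  (col : ∀ i → Fin (colsM k q i) ↔ Poly (F i) k)
  (row-prefix : ∀ i r r′ → toℕ r ≡ toℕ r′ →
                Inverse.to (row (suc i)) r′ ≡ map₂ (FieldHom.⟦ emb i ⟧) (Inverse.to (row i) r))
  (col-prefix : ∀ i c c′ → toℕ c ≡ toℕ c′ →
                Inverse.to (col (suc i)) c′ ≡ Vec.map FieldHom.⟦ emb i ⟧ (Inverse.to (col i) c))
  where
  open Inverse

  M : (i : ℕ) → Matrix (rowsM d k q i) (colsM k q i)
  M i = RSMatrix d k F emb xs i (to (row i)) (to (col i))

  M-embed : ∀ i r r′ c c′ → toℕ r ≡ toℕ r′ → toℕ c ≡ toℕ c′ → M (suc i) r′ c′ ≡ M i r c
  M-embed i r r′ c c′ r≡r′ c≡c′ =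
    trans (evalMatrix-at (F (suc i)) (lift F emb (suc i) ∘ xs) (to (row (suc i))) (to (col (suc i)))
             (row-prefix i r r′ r≡r′) (col-prefix i c c′ c≡c′))
          (FieldHomProperties.⌊⌋-eval-map (emb i) (to (col i) c) _ _)

  new-row-value∉image : ∀ i r′ → rowsM d k q i ≤ toℕ r′ →
                        ∀ v → proj₂ (to (row (suc i)) r′) ≢ FieldHom.⟦ emb i ⟧ v
  new-row-value∉image i r′ t≤r′ v =
    beyond-prefix-∉image (row i) (row (suc i)) (map₂ FieldHom.⟦ emb i ⟧) (rowsM-mono d k q i)
      (row-prefix i) r′ t≤r′ (proj₁ (to (row (suc i)) r′) , v) ∘ cong (proj₁ (to (row (suc i)) r′) ,_)

  M-Z-zero : ∀ i r′ c c′ → rowsM d k q i ≤ toℕ r′ → toℕ c ≡ toℕ c′ → M (suc i) r′ c′ ≡ false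
  M-Z-zero i r′ c c′ t≤r′ c≡c′ =
    trans (evalMatrix-at (F (suc i)) (lift F emb (suc i) ∘ xs) (to (row (suc i))) (to (col (suc i)))
             refl (col-prefix i c c′ c≡c′))
          (FieldHomProperties.⌊⌋-eval-map-∉image (emb i) (to (col i) c) _ _ (new-row-value∉image i r′ t≤r′))

  M-isMonotoneFamily : MonotoneFamily d (rowsM d k q) (colsM k q) M
  M-isMonotoneFamily = record
    { cff    = λ i → evalMatrix-isCFF (F i) d k (lift F emb i ∘ xs)
                       (xs-injective ∘ lift-injective F emb i) (row i) (col i)
    ; rows-≤ = rowsM-mono d k q
    ; cols-≤ = colsM-mono k q
    ; embed  = M-embed
    ; Z-zero = M-Z-zero
    }

theorem5 : (d k q : ℕ) → 1 ≤ d → 1 ≤ k → IsPrimePower q → d * k + 1 ≤ q →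
  -- tower of finite fields F i = 𝔽_{q^(2^i)} with embeddings F i ⊆ F (i+1)
  (F : ℕ → Field) →
  (size : ∀ i → Field.Carrier (F i) ↔ Fin (q ^ (2 ^ i))) →
  (emb : ∀ i → FieldHom (F i) (F (suc i))) →
  -- the distinct elements x_1, …, x_{dk+1} of 𝔽_q
  (xs : Fin (d * k + 1) → Field.Carrier (F 0)) → Injective _≡_ _≡_ xs →
  -- orderings of rows and columns of M_i
  (row : ∀ i → Fin (rowsM d k q i) ↔ (Fin (d * k + 1) × Field.Carrier (F i))) →
  (col : ∀ i → Fin (colsM k q i) ↔ Poly (F i) k) →
  -- rows/columns of M_(i-1) come first, in the order used for M_(i-1)
  (∀ i (r : Fin (rowsM d k q i)) (r' : Fin (rowsM d k q (suc i))) →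
     toℕ r ≡ toℕ r' →
     Inverse.to (row (suc i)) r'
       ≡ (proj₁ (Inverse.to (row i) r) ,
          FieldHom.⟦ emb i ⟧ (proj₂ (Inverse.to (row i) r)))) →
  (∀ i (c : Fin (colsM k q i)) (c' : Fin (colsM k q (suc i))) →
     toℕ c ≡ toℕ c' →
     Inverse.to (col (suc i)) c' ≡ Vec.map FieldHom.⟦ emb i ⟧ (Inverse.to (col i) c)) →
  let M = λ i → RSMatrix d k F emb xs i (Inverse.to (row i)) (Inverse.to (col i)) in
  MonotoneFamily d (rowsM d k q) (colsM k q) M
  -- compression ratio: n/t = O(n^(1 - 1/(k+1))), i.e. (n/t)^(k+1) ≤ C n^k
  × ∃[ C ] (∀ i → colsM k q i ^ (k + 1)
                    ≤ C * rowsM d k q i ^ (k + 1) * colsM k q i ^ k)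
theorem5 d k q _ _ _ dk+1≤q F _ emb xs xs-injective row col row-prefix col-prefix =
  RSTower.M-isMonotoneFamily d k q {{q≢0}} F emb xs xs-injective row col row-prefix col-prefix ,
  1 , λ i → n^[k+1]≤t^[k+1]*n^k k (colsM≤rowsM^[k+1] d k q i)
  where
    q≢0 : NonZero q
    q≢0 = >-nonZero (≤-trans (m≤n+m 1 (d * k)) dk+1≤q)
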